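{- For every odd integer $n\geq 5$, $\mathrm{R}(W_n,W_n)\geq 2n$.
   Context: For an integer $n\geq 4$, the wheel $W_n$ is the graph on $n$ vertices obtained from the cycle $C_{n-1}$ by adding one new vertex adjacent to every vertex of the cycle. $\mathrm{R}(G_1,G_2)$ is the smallest integer $N$ such that every red-blue coloring of the edges of $K_N$ contains a red copy of $G_1$ or a blue copy of $G_2$. -}

module Defs where

open import Data.Nat using (ℕ; zero; suc; _∸_; _≤_)
open import Data.Fin using (Fin; toℕ)
open import Data.Bool using (Bool; true; false)
open import Data.Product using (_×_; Σ)
open import Data.Sum using (_⊎_)
open import Relation.Binary.PropositionalEquality using (_≡_)
open import Function.Definitions using (Injective)

record Graph : Set₁ where
  field
    size : ℕ
    Adj  : Fin size → Fin size → Set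
open Graph public

-- Wheel W_n, vertices labelled 0,1,…,n-1: vertex 0 is the hub, vertices 1,…,n-1 form the
-- cycle C_{n-1} in the order 1 – 2 – … – (n-1) – 1.
-- RimNext n a b : b is the successor of a on the rim cycle.
RimNext : ℕ → ℕ → ℕ → Set
RimNext n a b = (1 ≤ a × suc a ≡ b × b ≤ n ∸ 1) ⊎ (a ≡ n ∸ 1 × b ≡ 1)

WheelAdjℕ : ℕ → ℕ → ℕ → Set
WheelAdjℕ n a b =
  (a ≡ 0 × 1 ≤ b) ⊎ (b ≡ 0 × 1 ≤ a) ⊎ RimNext n a b ⊎ RimNext n b a

Wheel : ℕ → Graph
Wheel n = record { size = n ; Adj = λ u v → WheelAdjℕ n (toℕ u) (toℕ v) }

-- A red/blue colouring of the edges of K_N: red = true, blue = false.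
-- Only the values on pairs of distinct vertices matter; colourings are symmetric.
Colouring : ℕ → Set
Colouring N = Fin N → Fin N → Bool

Symmetric : ∀ {N} → Colouring N → Set
Symmetric {N} c = ∀ (i j : Fin N) → c i j ≡ c j i

MonoCopy : ∀ {N} → Colouring N → Bool → Graph → Set
MonoCopy {N} c b G =
  Σ (Fin (size G) → Fin N) λ f →
    Injective _≡_ _≡_ f × (∀ u v → Adj G u v → c (f u) (f v) ≡ b)

Arrows : Graph → Graph → ℕ → Set
Arrows G₁ G₂ N =
  (c : Colouring N) → Symmetric c → MonoCopy c true G₁ ⊎ MonoCopy c false G₂

{-# OPTIONS --safe #-}
module Submission where

-- For n = 5, colour K₉ red along the 3 × 3 rook's graph (same row or same column). Every
-- edge of it, and every edge of its complement, lies in exactly one triangle of its colour,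
-- so there is no monochromatic diamond (K₄ minus an edge), while W₅ contains a diamond.
--
-- For odd n ≥ 7, colour K_{2n-1} on A ∪ B with |A| = n and |B| = n - 1: B is a red clique,
-- the A–B edges are blue, and A is cut into blocks of size 2 or 3 (one triple, as n is odd),
-- blue inside a block and red between blocks. A red wheel lies on the side of its hub: B is
-- too small for it, and in A the rim avoids the whole block of the hub, leaving only n - 2
-- vertices for it. In a blue wheel with hub in B the rim is a blue-connected subgraph of A,
-- hence inside one block of size at most 3. With hub in A, every rim vertex is in B or in
-- the hub's block; since B is red, each of the disjoint rim edges v₁v₂, v₃v₄, v₅v₆ has an
-- end in that block, which would then hold four vertices.

open import Defs
open import Data.Nat
  using (ℕ; zero; suc; pred; _+_; _*_; _∸_; _/_; _%_; _≤_; _<_; ⌊_/2⌋; z≤n; s≤s; _<?_)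
open import Data.Nat.Properties
  using ( <-trans; <-irrefl; <⇒≱; ≮⇒≥; <-≤-connex; ≤-refl
        ; ∸-monoˡ-<; ∸-cancelʳ-≡; m+n∸m≡n; *-suc; +-suc; +-identityʳ)
  renaming (_≟_ to _≟ℕ_)
open import Data.Fin using (Fin; zero; suc; toℕ; fromℕ; fromℕ<; inject≤; _≟_; #_)
open import Data.Fin.Properties
  using ( all?; injective⇒≤; toℕ-fromℕ<; toℕ-fromℕ; toℕ-injective; toℕ<n; toℕ≤pred[n]
        ; inject≤-injective)
open import Data.Bool using (Bool; true; false; _∨_)
open import Data.Bool.Properties using () renaming (_≟_ to _≟B_)
open import Data.Empty using (⊥; ⊥-elim)
open import Data.Product using (_×_; _,_; proj₁; proj₂; Σ-syntax)
open import Data.Sum using (_⊎_; inj₁; inj₂; [_,_]′)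
open import Data.Vec using (Vec; _∷_; []; lookup)
open import Data.Vec.Relation.Unary.All using (All; _∷_; []) renaming (all? to allᵥ?)
import Data.Vec.Relation.Unary.All.Properties as All
open import Data.Vec.Relation.Unary.AllPairs using (allPairs?; _∷_; [])
open import Data.Vec.Relation.Unary.Unique.Propositional using (Unique)
import Data.Vec.Relation.Unary.Unique.Propositional.Properties as Unique
import Data.Vec.Functional as Vector
open import Function using (_∘_)
open import Function.Definitions using (Injective)
open import Relation.Nullary using (Dec; yes; no; ¬_; ¬?; does; _×-dec_; contradiction)
open import Relation.Nullary.Decidable using (True; toWitness; from-yes)
open import Relation.Binary.PropositionalEquality
  using (_≡_; _≢_; refl; sym; trans; cong; subst; module ≡-Reasoning)

bounded-injection⇒≤ : ∀ {k m} (g : Fin k → ℕ) → Injective _≡_ _≡_ g →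
                      (∀ i → g i < m) → k ≤ m
bounded-injection⇒≤ g g-inj g<m = injective⇒≤ {f = λ i → fromℕ< (g<m i)} λ {i} {j} e →
  g-inj (begin
    g i                  ≡⟨ sym (toℕ-fromℕ< (g<m i)) ⟩
    toℕ (fromℕ< (g<m i)) ≡⟨ cong toℕ e ⟩
    toℕ (fromℕ< (g<m j)) ≡⟨ toℕ-fromℕ< (g<m j) ⟩
    g j                  ∎)
  where open ≡-Reasoning

interval-injection⇒≤ : ∀ {k a m} (g : Fin k → ℕ) → Injective _≡_ _≡_ g →
                       (∀ i → a ≤ g i) → (∀ i → g i < a + m) → k ≤ m
interval-injection⇒≤ {a = a} {m} g g-inj a≤g g<a+m =
  bounded-injection⇒≤ (λ i → g i ∸ a)
    (λ e → g-inj (∸-cancelʳ-≡ (a≤g _) (a≤g _) e))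
    (λ i → subst (g i ∸ a <_) (m+n∸m≡n a m) (∸-monoˡ-< (g<a+m i) (a≤g i)))

avoiding-injection⇒< : ∀ {k m w} (g : Fin k → ℕ) → Injective _≡_ _≡_ g →
                       (∀ i → g i < m) → w < m → (∀ i → g i ≢ w) → k < m
avoiding-injection⇒< {w = w} g g-inj g<m w<m g≢w =
  bounded-injection⇒≤ (w Vector.∷ g) w∷g-inj λ where
    zero    → w<m
    (suc i) → g<m i
  where
    w∷g-inj : Injective _≡_ _≡_ (w Vector.∷ g)
    w∷g-inj {zero}  {zero}  _ = refl
    w∷g-inj {zero}  {suc j} e = ⊥-elim (g≢w j (sym e))
    w∷g-inj {suc i} {zero}  e = ⊥-elim (g≢w i e)
    w∷g-inj {suc i} {suc j} e = cong suc (g-inj e)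

restrict : ∀ {M N} → N ≤ M → Colouring M → Colouring N
restrict N≤M c i j = c (inject≤ i N≤M) (inject≤ j N≤M)

restrict-sym : ∀ {M N} (N≤M : N ≤ M) {c : Colouring M} →
               Symmetric c → Symmetric (restrict N≤M c)
restrict-sym N≤M c-sym i j = c-sym (inject≤ i N≤M) (inject≤ j N≤M)

restrict-copy : ∀ {M N} (N≤M : N ≤ M) {c : Colouring M} {b G} →
                MonoCopy (restrict N≤M c) b G → MonoCopy c b G
restrict-copy N≤M (f , f-inj , mono) =
  (λ u → inject≤ (f u) N≤M) , (λ e → f-inj (inject≤-injective N≤M N≤M _ _ e)) , mono

good-colouring⇒< : ∀ {M N G₁ G₂} (c : Colouring M) → Symmetric c →
                   ¬ MonoCopy c true G₁ → ¬ MonoCopy c false G₂ → Arrows G₁ G₂ N → M < N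
good-colouring⇒< {M} {N} c c-sym no-red no-blue arrows with M <? N
... | yes M<N = M<N
... | no M≮N = ⊥-elim ([ no-red ∘ restrict-copy N≤M {c} , no-blue ∘ restrict-copy N≤M {c} ]′
                         (arrows (restrict N≤M c) (restrict-sym N≤M c-sym)))
  where N≤M = ≮⇒≥ M≮N

spoke : ∀ {r} (u : Fin r) → Adj (Wheel (suc r)) zero (suc u)
spoke u = inj₁ (refl , s≤s z≤n)

rim-edge : ∀ {r} (u v : Fin (suc r)) → 1 ≤ toℕ u → suc (toℕ u) ≡ toℕ v →
           Adj (Wheel (suc r)) u v
rim-edge u v 1≤u u+1≡v = inj₂ (inj₂ (inj₁ (inj₁ (1≤u , u+1≡v , toℕ≤pred[n] v))))

rook : Colouring 9
rook a b = does (toℕ a / 3 ≟ℕ toℕ b / 3) ∨ does (toℕ a % 3 ≟ℕ toℕ b % 3)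

rook-sym : Symmetric rook
rook-sym = from-yes (all? λ a → all? λ b → rook a b ≟B rook b a)

MonoDiamond : ∀ {N} → Colouring N → Bool → Fin N → Fin N → Fin N → Fin N → Set
MonoDiamond c b h x y z =
  Unique (h ∷ x ∷ y ∷ z ∷ []) × All (_≡ b) (c h x ∷ c h y ∷ c h z ∷ c x y ∷ c x z ∷ [])

monoDiamond? : ∀ {N} (c : Colouring N) b h x y z → Dec (MonoDiamond c b h x y z)
monoDiamond? c b h x y z = allPairs? (λ u v → ¬? (u ≟ v)) _ ×-dec allᵥ? (_≟B b) _

rook-diamond-free : ∀ b h x y z → ¬ MonoDiamond rook b h x y z
rook-diamond-free true  = from-yes (all? λ h → all? λ x → all? λ y → all? λ z →
                                      ¬? (monoDiamond? rook true h x y z))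
rook-diamond-free false = from-yes (all? λ h → all? λ x → all? λ y → all? λ z →
                                      ¬? (monoDiamond? rook false h x y z))

wheel-diamond : ∀ {N k} {c : Colouring N} {b} → MonoCopy c b (Wheel (4 + k)) →
                Σ[ h ∈ Fin N ] Σ[ x ∈ Fin N ] Σ[ y ∈ Fin N ] Σ[ z ∈ Fin N ] MonoDiamond c b h x y z
wheel-diamond {k = k} (f , f-inj , mono) =
  f zero , f (# 1) , f (# 2) , f last , distinct ,
  mono _ _ (spoke _) ∷ mono _ _ (spoke _) ∷ mono _ _ (spoke _) ∷
  mono _ _ (rim-edge _ _ (s≤s z≤n) refl) ∷
  mono _ _ (inj₂ (inj₂ (inj₂ (inj₂ (toℕ-fromℕ (3 + k) , refl))))) ∷ []
  where
    last : Fin (4 + k)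
    last = fromℕ (3 + k)
    distinct : Unique (f zero ∷ f (# 1) ∷ f (# 2) ∷ f last ∷ [])
    distinct = ((λ ()) ∘ f-inj ∷ (λ ()) ∘ f-inj ∷ (λ ()) ∘ f-inj ∷ []) ∷
               ((λ ()) ∘ f-inj ∷ (λ ()) ∘ f-inj ∷ []) ∷
               ((λ ()) ∘ f-inj ∷ []) ∷ [] ∷ []

rook-wheel-free : ∀ {k} b → ¬ MonoCopy rook b (Wheel (4 + k))
rook-wheel-free b copy with wheel-diamond copy
... | h , x , y , z , diamond = rook-diamond-free b h x y z diamond

-- The blocks are {0,1,2}, {3,4}, {5,6}, …
block : ℕ → ℕ
block x = ⌊ pred x /2⌋

block-bounds : ∀ x → 2 * block x ≤ x × x < 2 * block x + 3
block-bounds 0 = z≤n , s≤s z≤n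
block-bounds 1 = z≤n , s≤s (s≤s z≤n)
block-bounds 2 = z≤n , s≤s (s≤s (s≤s z≤n))
block-bounds (suc (suc (suc y))) with block-bounds (suc y)
... | lower , upper =
  subst (_≤ 3 + y) 2+2q≡2[1+q] (s≤s (s≤s lower)) ,
  subst (λ b → 3 + y < b + 3) 2+2q≡2[1+q] (s≤s (s≤s upper))
  where
    2+2q≡2[1+q] : 2 + 2 * block (suc y) ≡ 2 * block (3 + y)
    2+2q≡2[1+q] = sym (*-suc 2 (block (suc y)))

at-most-three-per-block : ∀ {k q} {xs : Vec ℕ k} → Unique xs →
                          All (λ x → block x ≡ q) xs → k ≤ 3
at-most-three-per-block {q = q} {xs} distinct in-q =
  interval-injection⇒≤ (lookup xs) (Unique.lookup-injective distinct _ _)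
    (proj₁ ∘ bounds) (proj₂ ∘ bounds)
  where
    bounds : ∀ i → 2 * q ≤ lookup xs i × lookup xs i < 2 * q + 3
    bounds i = subst (λ b → 2 * b ≤ lookup xs i × lookup xs i < 2 * b + 3)
                     (All.lookup⁺ in-q i) (block-bounds (lookup xs i))

flip : ℕ → ℕ
flip 0 = 1
flip 1 = 0
flip (suc (suc y)) = suc (suc (flip y))

flip-≢ : ∀ y → flip y ≢ y
flip-≢ 0 ()
flip-≢ 1 ()
flip-≢ (suc (suc y)) e = flip-≢ y (cong (pred ∘ pred) e)

⌊flip/2⌋ : ∀ y → ⌊ flip y /2⌋ ≡ ⌊ y /2⌋
⌊flip/2⌋ 0 = refl
⌊flip/2⌋ 1 = refl
⌊flip/2⌋ (suc (suc y)) = cong suc (⌊flip/2⌋ y)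

mate : ℕ → ℕ
mate zero    = 1
mate (suc y) = suc (flip y)

mate-≢ : ∀ x → mate x ≢ x
mate-≢ zero    ()
mate-≢ (suc y) e = flip-≢ y (cong pred e)

block-mate : ∀ x → block (mate x) ≡ block x
block-mate zero    = refl
block-mate (suc y) = ⌊flip/2⌋ y

-- For odd n, {0, …, n-1} is a union of blocks.
mate-< : ∀ {x n} → n % 2 ≡ 1 → 3 ≤ n → x < n → mate x < n
mate-< {zero}  _   3≤n _   = <-trans (s≤s (s≤s z≤n)) 3≤n
mate-< {suc y} odd _   x<n = suc-flip-< odd x<n
  where
    suc-flip-< : ∀ {y n} → n % 2 ≡ 1 → suc y < n → suc (flip y) < n
    suc-flip-< {0} {1} _ (s≤s ())
    suc-flip-< {0} {2} () _
    suc-flip-< {0} {suc (suc (suc n))} _ _ = s≤s (s≤s (s≤s z≤n))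
    suc-flip-< {1} _ 2<n = <-trans (s≤s (s≤s z≤n)) 2<n
    suc-flip-< {suc (suc y)} {suc (suc n)} odd (s≤s (s≤s y<n)) = s≤s (s≤s (suc-flip-< odd y<n))

module SplitColouring (n : ℕ) where

  colour : ℕ → ℕ → Bool
  colour x y with x <? n | y <? n | block x ≟ℕ block y
  ... | yes _ | yes _ | yes _ = false
  ... | yes _ | yes _ | no _  = true
  ... | no _  | no _  | _     = true
  ... | yes _ | no _  | _     = false
  ... | no _  | yes _ | _     = false

  colour-sym : ∀ x y → colour x y ≡ colour y x
  colour-sym x y with x <? n | y <? n | block x ≟ℕ block y | block y ≟ℕ block x
  ... | yes _ | yes _ | yes _ | yes _ = refl
  ... | yes _ | yes _ | yes e | no ne = contradiction (sym e) ne
  ... | yes _ | yes _ | no ne | yes e = contradiction (sym e) ne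
  ... | yes _ | yes _ | no _  | no _  = refl
  ... | no _  | no _  | _     | _     = refl
  ... | yes _ | no _  | _     | _     = refl
  ... | no _  | yes _ | _     | _     = refl

  red-inside : ∀ {x y} → colour x y ≡ true → x < n → y < n × block x ≢ block y
  red-inside {x} {y} red x<n with x <? n | y <? n | block x ≟ℕ block y
  ... | yes _  | yes y<n | no ne = y<n , ne
  ... | no x≮n | _       | _     = contradiction x<n x≮n
  ... | yes _  | yes _   | yes _ with () ← red
  ... | yes _  | no _    | _     with () ← red

  red-outside : ∀ {x y} → colour x y ≡ true → n ≤ x → n ≤ y
  red-outside {x} {y} red n≤x with x <? n | y <? n | block x ≟ℕ block y
  ... | yes x<n | _      | _ = contradiction n≤x (<⇒≱ x<n)
  ... | no _    | no y≮n | _ = ≮⇒≥ y≮n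
  ... | no _    | yes _  | _ with () ← red

  blue-inside : ∀ {x y} → colour x y ≡ false → x < n → y < n → block x ≡ block y
  blue-inside {x} {y} blue x<n y<n with x <? n | y <? n | block x ≟ℕ block y
  ... | _      | _      | yes e = e
  ... | yes _  | yes _  | no _  with () ← blue
  ... | no x≮n | _      | no _  = contradiction x<n x≮n
  ... | yes _  | no y≮n | no _  = contradiction y<n y≮n

  blue-outside : ∀ {x y} → colour x y ≡ false → n ≤ x → y < n
  blue-outside {x} {y} blue n≤x with x <? n | y <? n | block x ≟ℕ block y
  ... | yes x<n | _       | _ = contradiction n≤x (<⇒≱ x<n)
  ... | no _    | yes y<n | _ = y<n
  ... | no _    | no _    | _ with () ← blue

  colouring : (m : ℕ) → Colouring (n + m)
  colouring m i j = colour (toℕ i) (toℕ j)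

  colouring-sym : ∀ m → Symmetric (colouring m)
  colouring-sym m i j = colour-sym (toℕ i) (toℕ j)

module _ {r : ℕ} where
  open SplitColouring (suc r)

  no-red-star : ∀ {m} → suc r % 2 ≡ 1 → 3 ≤ suc r → m < suc r →
                (F : Fin (suc r) → ℕ) → Injective _≡_ _≡_ F → (∀ u → F u < suc r + m) →
                (∀ u → colour (F zero) (F (suc u)) ≡ true) → ⊥
  no-red-star odd 3≤n m<n F F-inj F<n+m red with <-≤-connex (F zero) (suc r)
  ... | inj₂ n≤h = <⇒≱ m<n (interval-injection⇒≤ F F-inj outside F<n+m)
    where
      outside : ∀ u → suc r ≤ F u
      outside zero    = n≤h
      outside (suc u) = red-outside (red u) n≤h
  ... | inj₁ h<n = <-irrefl refl (avoiding-injection⇒< F F-inj inside (mate-< odd 3≤n h<n) avoids)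
    where
      inside : ∀ u → F u < suc r
      inside zero    = h<n
      inside (suc u) = proj₁ (red-inside (red u) h<n)
      avoids : ∀ u → F u ≢ mate (F zero)
      avoids zero      = mate-≢ (F zero) ∘ sym
      avoids (suc u) e = proj₂ (red-inside (red u) h<n)
        (trans (sym (block-mate (F zero))) (cong block (sym e)))

  no-red-wheel : ∀ {m} → suc r % 2 ≡ 1 → 3 ≤ suc r → m < suc r →
                 ¬ MonoCopy (colouring m) true (Wheel (suc r))
  no-red-wheel odd 3≤n m<n (f , f-inj , red) =
    no-red-star odd 3≤n m<n (toℕ ∘ f) (f-inj ∘ toℕ-injective) (toℕ<n ∘ f)
      (λ u → red zero (suc u) (spoke u))

module _ {k : ℕ} where
  open SplitColouring (7 + k)

  module _ (F : Fin (7 + k) → ℕ) (F-inj : Injective _≡_ _≡_ F)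
           (blue : ∀ u v → Adj (Wheel (7 + k)) u v → colour (F u) (F v) ≡ false) where

    four-in-block : ∀ {q} (vs : Vec (Fin (7 + k)) 4)
                    {distinct : True (allPairs? (λ u v → ¬? (u ≟ v)) vs)} →
                    All (λ v → block (F v) ≡ q) vs → ⊥
    four-in-block vs {distinct} same = <-irrefl refl
      (at-most-three-per-block (Unique.map⁺ F-inj (toWitness distinct)) (All.map⁺ same))

    rim-edge-meets-hub-block : F zero < 7 + k → ∀ u v → Adj (Wheel (7 + k)) (suc u) (suc v) →
      block (F (suc u)) ≡ block (F zero) ⊎ block (F (suc v)) ≡ block (F zero)
    rim-edge-meets-hub-block h<n u v uv with <-≤-connex (F (suc u)) (7 + k)
    ... | inj₁ u<n = inj₁ (sym (blue-inside (blue zero (suc u) (spoke u)) h<n u<n))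
    ... | inj₂ n≤u = inj₂ (sym (blue-inside (blue zero (suc v) (spoke v)) h<n
                                 (blue-outside (blue (suc u) (suc v) uv) n≤u)))

    no-blue-wheel-ℕ : ⊥
    no-blue-wheel-ℕ with <-≤-connex (F zero) (7 + k)
    ... | inj₂ n≤h = four-in-block (# 1 ∷ # 2 ∷ # 3 ∷ # 4 ∷ [])
                       (trans e12 (trans e23 e34) ∷ trans e23 e34 ∷ e34 ∷ refl ∷ [])
      where
        inside : ∀ u → F (suc u) < 7 + k
        inside u = blue-outside (blue zero (suc u) (spoke u)) n≤h
        e12 : block (F (# 1)) ≡ block (F (# 2))
        e12 = blue-inside (blue (# 1) (# 2) (rim-edge _ _ (s≤s z≤n) refl)) (inside _) (inside _)
        e23 : block (F (# 2)) ≡ block (F (# 3))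
        e23 = blue-inside (blue (# 2) (# 3) (rim-edge _ _ (s≤s z≤n) refl)) (inside _) (inside _)
        e34 : block (F (# 3)) ≡ block (F (# 4))
        e34 = blue-inside (blue (# 3) (# 4) (rim-edge _ _ (s≤s z≤n) refl)) (inside _) (inside _)
    ... | inj₁ h<n
      with rim-edge-meets-hub-block h<n (# 0) (# 1) (rim-edge _ _ (s≤s z≤n) refl)
         | rim-edge-meets-hub-block h<n (# 2) (# 3) (rim-edge _ _ (s≤s z≤n) refl)
         | rim-edge-meets-hub-block h<n (# 4) (# 5) (rim-edge _ _ (s≤s z≤n) refl)
    ... | inj₁ a | inj₁ b | inj₁ c = four-in-block (# 0 ∷ # 1 ∷ # 3 ∷ # 5 ∷ []) (refl ∷ a ∷ b ∷ c ∷ [])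
    ... | inj₁ a | inj₁ b | inj₂ c = four-in-block (# 0 ∷ # 1 ∷ # 3 ∷ # 6 ∷ []) (refl ∷ a ∷ b ∷ c ∷ [])
    ... | inj₁ a | inj₂ b | inj₁ c = four-in-block (# 0 ∷ # 1 ∷ # 4 ∷ # 5 ∷ []) (refl ∷ a ∷ b ∷ c ∷ [])
    ... | inj₁ a | inj₂ b | inj₂ c = four-in-block (# 0 ∷ # 1 ∷ # 4 ∷ # 6 ∷ []) (refl ∷ a ∷ b ∷ c ∷ [])
    ... | inj₂ a | inj₁ b | inj₁ c = four-in-block (# 0 ∷ # 2 ∷ # 3 ∷ # 5 ∷ []) (refl ∷ a ∷ b ∷ c ∷ [])
    ... | inj₂ a | inj₁ b | inj₂ c = four-in-block (# 0 ∷ # 2 ∷ # 3 ∷ # 6 ∷ []) (refl ∷ a ∷ b ∷ c ∷ [])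
    ... | inj₂ a | inj₂ b | inj₁ c = four-in-block (# 0 ∷ # 2 ∷ # 4 ∷ # 5 ∷ []) (refl ∷ a ∷ b ∷ c ∷ [])
    ... | inj₂ a | inj₂ b | inj₂ c = four-in-block (# 0 ∷ # 2 ∷ # 4 ∷ # 6 ∷ []) (refl ∷ a ∷ b ∷ c ∷ [])

  no-blue-wheel : ∀ {m} → ¬ MonoCopy (colouring m) false (Wheel (7 + k))
  no-blue-wheel (f , f-inj , blue) = no-blue-wheel-ℕ (toℕ ∘ f) (f-inj ∘ toℕ-injective) blue

suc[n+pred[n]]≡2n : ∀ r → suc (suc r + r) ≡ 2 * suc r
suc[n+pred[n]]≡2n r = cong suc (begin
  suc (r + r)       ≡⟨ +-suc r r ⟨
  r + suc r         ≡⟨ cong (λ t → r + suc t) (+-identityʳ r) ⟨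
  r + suc (r + 0)   ∎)
  where open ≡-Reasoning

proposition2p2 : ∀ (n : ℕ) → n % 2 ≡ 1 → 5 ≤ n →
    ∀ (N : ℕ) → Arrows (Wheel n) (Wheel n) N → 2 * n ≤ N
proposition2p2 .5 _ (s≤s (s≤s (s≤s (s≤s (s≤s (z≤n {0})))))) N arrows =
  good-colouring⇒< rook rook-sym (rook-wheel-free true) (rook-wheel-free false) arrows
proposition2p2 .6 () (s≤s (s≤s (s≤s (s≤s (s≤s (z≤n {1})))))) N arrows
proposition2p2 .(7 + k) odd (s≤s (s≤s (s≤s (s≤s (s≤s (z≤n {suc (suc k)})))))) N arrows =
  subst (_≤ N) (suc[n+pred[n]]≡2n (6 + k))
    (good-colouring⇒< (colouring (6 + k)) (colouring-sym (6 + k))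
       (no-red-wheel odd (s≤s (s≤s (s≤s z≤n))) ≤-refl) no-blue-wheel arrows)
  where open SplitColouring (7 + k)
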